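{- Let $\mathcal M$ be a coalition model satisfying $\alpha$-duality at every state, and fix a state $w$. For a pair $(C,\varphi)$ with $C\subseteq N$, $\varphi\in\mathcal L_{CL}$, let $\mathrm{cat}(C,\varphi)\in\{\mathrm{FC},\mathrm{PD},\mathrm{AD},\mathrm{FI}\}$ be the unique category holding at $w$ (i.e. determined by the pair of truth values of $[C]\varphi$ and $[C]\neg\varphi$ at $w$: $(T,T)\mapsto\mathrm{FC}$, $(T,F)\mapsto\mathrm{PD}$, $(F,T)\mapsto\mathrm{AD}$, $(F,F)\mapsto\mathrm{FI}$). Consider the transformations $\mathrm{id}$, $f_{\mathrm{neg}}(C,\varphi)=(C,\neg\varphi)$, $f_{\mathrm{comp}}(C,\varphi)=(\overline C,\varphi)$, and $f_{\mathrm{both}}=f_{\mathrm{neg}}\circ f_{\mathrm{comp}}$. Then each of these transformations $f$ induces a permutation $\pi_f$ of the four categories, i.e. $\mathrm{cat}(f(C,\varphi))=\pi_f(\mathrm{cat}(C,\varphi))$ for all $C,\varphi$, and the set $\{\pi_{\mathrm{id}},\pi_{f_{\mathrm{neg}}},\pi_{f_{\mathrm{comp}}},\pi_{f_{\mathrm{both}}}\}$ is a group (under composition) isomorphic to the Klein four-group $\mathbb Z_2\times\mathbb Z_2$.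
   Context: Let $N=\{1,\dots,n\}$ be a finite set of agents, $\mathsf{Prop}$ a countable set of atoms; a coalition is any $C\subseteq N$ and $\overline C=N\setminus C$. The language $\mathcal L_{CL}$: $\varphi::=p\mid\neg\varphi\mid(\varphi\wedge\psi)\mid[C]\varphi$. A coalition model is $\mathcal M=(W,E,V)$ with $W\ne\emptyset$, $E_w(C)\subseteq\mathcal P(W)$ for each $w\in W$, $C\subseteq N$, $V:\mathsf{Prop}\to\mathcal P(W)$; atoms via $V$, Booleans classical, $\mathcal M,w\models[C]\varphi$ iff $\{u\mid\mathcal M,u\models\varphi\}\in E_w(C)$. For $X\subseteq W$, $\overline X=W\setminus X$. $E_w$ satisfies $\alpha$-duality if for all $C\subseteq N$, $X\subseteq W$: $X\in E_w(C)$ iff $\overline X\notin E_w(\overline C)$. Categories: $\mathrm{FC}_C(\varphi):=[C]\varphi\wedge[C]\neg\varphi$; $\mathrm{PD}_C(\varphi):=[C]\varphi\wedge\neg[C]\neg\varphi$; $\mathrm{AD}_C(\varphi):=\neg[C]\varphi\wedge[C]\neg\varphi$; $\mathrm{FI}_C(\varphi):=\neg[C]\varphi\wedge\neg[C]\neg\varphi$. -}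

module Defs where

open import Data.Nat using (ℕ)
open import Data.Bool using (Bool; true; false; not; _∧_; _xor_)
open import Data.Product using (_×_; _,_)
open import Data.Fin.Subset using (Subset; ∁)
open import Function.Bundles using (_↔_)

data Form (n : ℕ) : Set where
  atom : ℕ → Form n
  ¬f   : Form n → Form n
  _∧f_ : Form n → Form n → Form n
  [_]f : Subset n → Form n → Form n

-- Subsets of W are represented by their (Boolean) characteristic functions.
record Model (n : ℕ) : Set₁ where
  field
    W : Set
    E : W → Subset n → (W → Bool) → Bool   -- X ∈ E_w(C)
    V : ℕ → W → Bool

module _ {n : ℕ} (M : Model n) where
  open Model M

  compl : (W → Bool) → (W → Bool)
  compl X u = not (X u)

  sat : Form n → W → Bool
  sat (atom p)   u = V p u
  sat (¬f φ)     u = not (sat φ u)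
  sat (φ ∧f ψ)   u = sat φ u ∧ sat ψ u
  sat ([ C ]f φ) u = E u C (λ v → sat φ v)

  AlphaDuality : W → Set
  AlphaDuality w = ∀ (C : Subset n) (X : W → Bool) →
    E w C X ≡ not (E w (∁ C) (compl X))
    where open import Relation.Binary.PropositionalEquality using (_≡_)

data Cat : Set where
  FC PD AD FI : Cat

catOf : Bool → Bool → Cat
catOf true  true  = FC
catOf true  false = PD
catOf false true  = AD
catOf false false = FI

Pair : ℕ → Set
Pair n = Subset n × Form n

cat : ∀ {n} (M : Model n) → Model.W M → Pair n → Cat
cat M w (C , φ) = catOf (sat M ([ C ]f φ) w) (sat M ([ C ]f (¬f φ)) w)

f-id f-neg f-comp f-both : ∀ {n} → Pair n → Pair n
f-id p = p
f-neg (C , φ) = (C , ¬f φ)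
f-comp (C , φ) = (∁ C , φ)
f-both p = f-neg (f-comp p)

Klein : Set
Klein = Bool × Bool

_⊕_ : Klein → Klein → Klein
(a , b) ⊕ (c , d) = (a xor c , b xor d)

kleinMap : (πid πneg πcomp πboth : Cat ↔ Cat) → Klein → Cat ↔ Cat
kleinMap πid πneg πcomp πboth (false , false) = πid
kleinMap πid πneg πcomp πboth (true  , false) = πneg
kleinMap πid πneg πcomp πboth (false , true)  = πcomp
kleinMap πid πneg πcomp πboth (true  , true)  = πboth

-- A category is the pair of truth values ([C]φ , [C]¬φ). Applying α-duality twice shows that
-- E_w(C) cannot tell X from its double complement, so [C]¬¬φ and [C]φ agree; applying it once
-- more gives [C̄]φ = ¬[C]¬φ. Hence f-neg swaps the pair while f-comp swaps and negates it: two
-- commuting involutions of the four categories, i.e. an action of Z₂ × Z₂. The action is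
-- faithful because f-neg moves PD while f-comp fixes it, and f-comp moves FC while f-neg fixes it.
module Submission where

open import Defs
open import Algebra.Definitions using (Involutive)
open import Data.Nat using (ℕ)
open import Data.Bool using (Bool; true; false; not; _xor_)
open import Data.Bool.Properties using (not-involutive; xor-same)
open import Data.Empty using (⊥-elim)
open import Data.Fin.Subset using (∁)
open import Data.Product using (Σ; _×_; _,_)
open import Data.Vec.Properties using (map-∘; map-cong; map-id)
open import Function.Base using (id)
open import Function.Bundles using (_↔_; Inverse; mk↔ₛ′)
open import Relation.Binary.PropositionalEquality
  using (_≡_; _≢_; _≗_; refl; sym; trans; cong; cong₂; module ≡-Reasoning)

∁-involutive : ∀ {n} → Involutive _≡_ (∁ {n})
∁-involutive C = trans (sym (map-∘ not not C)) (trans (map-cong not-involutive C) (map-id C))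

module KleinAction {a} {A : Set a} (f g : A → A)
  (f-involutive : Involutive _≡_ f) (g-involutive : Involutive _≡_ g)
  (f∘g≗g∘f : ∀ z → f (g z) ≡ g (f z)) where

  _^_ : (A → A) → Bool → A → A
  h ^ false = id
  h ^ true  = h

  ^-xor : ∀ {h} → Involutive _≡_ h → ∀ x y z → (h ^ (x xor y)) z ≡ (h ^ x) ((h ^ y) z)
  ^-xor h-inv false y     z = refl
  ^-xor h-inv true  false z = refl
  ^-xor h-inv true  true  z = sym (h-inv z)

  ^-comm : ∀ x y z → (f ^ x) ((g ^ y) z) ≡ (g ^ y) ((f ^ x) z)
  ^-comm false y     z = refl
  ^-comm true  false z = refl
  ^-comm true  true  z = f∘g≗g∘f z

  ^-fixes : ∀ {h z} → h z ≡ z → ∀ x → (h ^ x) z ≡ z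
  ^-fixes hz≡z false = refl
  ^-fixes hz≡z true  = hz≡z

  ^-injective-at : ∀ {h z} → h z ≢ z → ∀ x y → (h ^ x) z ≡ (h ^ y) z → x ≡ y
  ^-injective-at hz≢z false false _  = refl
  ^-injective-at hz≢z false true  eq = ⊥-elim (hz≢z (sym eq))
  ^-injective-at hz≢z true  false eq = ⊥-elim (hz≢z eq)
  ^-injective-at hz≢z true  true  _  = refl

  act : Klein → A → A
  act (x , y) z = (f ^ x) ((g ^ y) z)

  act-⊕ : ∀ k l z → act (k ⊕ l) z ≡ act k (act l z)
  act-⊕ (x₁ , y₁) (x₂ , y₂) z = begin
    (f ^ (x₁ xor x₂)) ((g ^ (y₁ xor y₂)) z)          ≡⟨ ^-xor f-involutive x₁ x₂ _ ⟩
    (f ^ x₁) ((f ^ x₂) ((g ^ (y₁ xor y₂)) z))         ≡⟨ cong (λ u → (f ^ x₁) ((f ^ x₂) u)) (^-xor g-involutive y₁ y₂ z) ⟩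
    (f ^ x₁) ((f ^ x₂) ((g ^ y₁) ((g ^ y₂) z)))       ≡⟨ cong (f ^ x₁) (^-comm x₂ y₁ _) ⟩
    (f ^ x₁) ((g ^ y₁) ((f ^ x₂) ((g ^ y₂) z)))       ∎
    where open ≡-Reasoning

  act-involutive : ∀ k → Involutive _≡_ (act k)
  act-involutive k@(x , y) z = begin
    act k (act k z)        ≡⟨ sym (act-⊕ k k z) ⟩
    act (k ⊕ k) z          ≡⟨ cong₂ (λ x′ y′ → act (x′ , y′) z) (xor-same x) (xor-same y) ⟩
    z                      ∎
    where open ≡-Reasoning

  act↔ : Klein → A ↔ A
  act↔ k = mk↔ₛ′ (act k) (act k) (act-involutive k) (act-involutive k)

  act-faithful : ∀ {p q} → f p ≢ p → g p ≡ p → f q ≡ q → g q ≢ q →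
                 ∀ k l → act k ≗ act l → k ≡ l
  act-faithful {p} {q} fp≢p gp≡p fq≡q gq≢q (x₁ , y₁) (x₂ , y₂) eq = cong₂ _,_
    (^-injective-at fp≢p x₁ x₂ (trans (sym (at-p x₁ y₁)) (trans (eq p) (at-p x₂ y₂))))
    (^-injective-at gq≢q y₁ y₂ (trans (sym (at-q x₁ y₁)) (trans (eq q) (at-q x₂ y₂))))
    where
    at-p : ∀ x y → act (x , y) p ≡ (f ^ x) p
    at-p x y = cong (f ^ x) (^-fixes gp≡p y)
    at-q : ∀ x y → act (x , y) q ≡ (g ^ y) q
    at-q x y = trans (^-comm x y q) (cong (g ^ y) (^-fixes fq≡q x))

negCat : Cat → Cat
negCat FC = FC
negCat PD = AD
negCat AD = PD
negCat FI = FI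

compCat : Cat → Cat
compCat FC = FI
compCat PD = PD
compCat AD = AD
compCat FI = FC

negCat-involutive : Involutive _≡_ negCat
negCat-involutive FC = refl
negCat-involutive PD = refl
negCat-involutive AD = refl
negCat-involutive FI = refl

compCat-involutive : Involutive _≡_ compCat
compCat-involutive FC = refl
compCat-involutive PD = refl
compCat-involutive AD = refl
compCat-involutive FI = refl

negCat-compCat-comm : ∀ c → negCat (compCat c) ≡ compCat (negCat c)
negCat-compCat-comm FC = refl
negCat-compCat-comm PD = refl
negCat-compCat-comm AD = refl
negCat-compCat-comm FI = refl

catOf-swap : ∀ a b → catOf b a ≡ negCat (catOf a b)
catOf-swap false false = refl
catOf-swap false true  = refl
catOf-swap true  false = refl
catOf-swap true  true  = refl

catOf-swap-not : ∀ a b → catOf (not b) (not a) ≡ compCat (catOf a b)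
catOf-swap-not false false = refl
catOf-swap-not false true  = refl
catOf-swap-not true  false = refl
catOf-swap-not true  true  = refl

module _ {n} (M : Model n) (w : Model.W M) (α : AlphaDuality M w) where
  open Model M

  E-compl-compl : ∀ C X → E w C (compl M (compl M X)) ≡ E w C X
  E-compl-compl C X = sym (begin
    E w C X                                              ≡⟨ α C X ⟩
    not (E w (∁ C) (compl M X))                          ≡⟨ cong not (α (∁ C) (compl M X)) ⟩
    not (not (E w (∁ (∁ C)) (compl M (compl M X))))      ≡⟨ not-involutive _ ⟩
    E w (∁ (∁ C)) (compl M (compl M X))                  ≡⟨ cong (λ D → E w D _) (∁-involutive C) ⟩
    E w C (compl M (compl M X))                          ∎)
    where open ≡-Reasoning

  E-∁ : ∀ C X → E w (∁ C) X ≡ not (E w C (compl M X))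
  E-∁ C X = begin
    E w (∁ C) X                                          ≡⟨ sym (E-compl-compl (∁ C) X) ⟩
    E w (∁ C) (compl M (compl M X))                      ≡⟨ sym (not-involutive _) ⟩
    not (not (E w (∁ C) (compl M (compl M X))))          ≡⟨ cong not (sym (α C (compl M X))) ⟩
    not (E w C (compl M X))                              ∎
    where open ≡-Reasoning

  box-¬¬ : ∀ C φ → sat M ([ C ]f (¬f (¬f φ))) w ≡ sat M ([ C ]f φ) w
  box-¬¬ C φ = E-compl-compl C (sat M φ)

  box-∁ : ∀ C φ → sat M ([ ∁ C ]f φ) w ≡ not (sat M ([ C ]f (¬f φ)) w)
  box-∁ C φ = E-∁ C (sat M φ)

  cat-neg : ∀ p → cat M w (f-neg p) ≡ negCat (cat M w p)
  cat-neg (C , φ) = trans (cong (catOf _) (box-¬¬ C φ)) (catOf-swap _ _)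

  cat-comp : ∀ p → cat M w (f-comp p) ≡ compCat (cat M w p)
  cat-comp (C , φ) = begin
    catOf (sat M ([ ∁ C ]f φ) w) (sat M ([ ∁ C ]f (¬f φ)) w)
      ≡⟨ cong₂ catOf (box-∁ C φ) (trans (box-∁ C (¬f φ)) (cong not (box-¬¬ C φ))) ⟩
    catOf (not (sat M ([ C ]f (¬f φ)) w)) (not (sat M ([ C ]f φ) w))
      ≡⟨ catOf-swap-not _ _ ⟩
    compCat (cat M w (C , φ))
      ∎
    where open ≡-Reasoning

  cat-both : ∀ p → cat M w (f-both p) ≡ negCat (compCat (cat M w p))
  cat-both p = trans (cat-neg (f-comp p)) (cong negCat (cat-comp p))

open KleinAction negCat compCat negCat-involutive compCat-involutive negCat-compCat-comm

kleinMap-tabulate : (F : Klein → Cat ↔ Cat) (k : Klein) →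
  kleinMap (F (false , false)) (F (true , false)) (F (false , true)) (F (true , true)) k ≡ F k
kleinMap-tabulate F (false , false) = refl
kleinMap-tabulate F (true  , false) = refl
kleinMap-tabulate F (false , true)  = refl
kleinMap-tabulate F (true  , true)  = refl

theorem5p5 : (n : ℕ) (M : Model n) → (∀ w → AlphaDuality M w) → (w : Model.W M) →
    Σ (Cat ↔ Cat) λ πid → Σ (Cat ↔ Cat) λ πneg → Σ (Cat ↔ Cat) λ πcomp → Σ (Cat ↔ Cat) λ πboth →
      ((∀ p → cat M w (f-id p) ≡ Inverse.to πid (cat M w p))
      × (∀ p → cat M w (f-neg p) ≡ Inverse.to πneg (cat M w p))
      × (∀ p → cat M w (f-comp p) ≡ Inverse.to πcomp (cat M w p))
      × (∀ p → cat M w (f-both p) ≡ Inverse.to πboth (cat M w p)))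
      × (∀ a b c → Inverse.to (kleinMap πid πneg πcomp πboth (a ⊕ b)) c
                   ≡ Inverse.to (kleinMap πid πneg πcomp πboth a) (Inverse.to (kleinMap πid πneg πcomp πboth b) c))
      × (∀ a b → (∀ c → Inverse.to (kleinMap πid πneg πcomp πboth a) c ≡ Inverse.to (kleinMap πid πneg πcomp πboth b) c) → a ≡ b)
theorem5p5 n M α w =
  act↔ (false , false) , act↔ (true , false) , act↔ (false , true) , act↔ (true , true) ,
  ((λ _ → refl) , cat-neg M w (α w) , cat-comp M w (α w) , cat-both M w (α w)) ,
  homomorphism , faithful
  where
  π : Klein → Cat ↔ Cat
  π = kleinMap (act↔ (false , false)) (act↔ (true , false)) (act↔ (false , true)) (act↔ (true , true))

  homomorphism : ∀ a b c → Inverse.to (π (a ⊕ b)) c ≡ Inverse.to (π a) (Inverse.to (π b) c)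
  homomorphism a b c
    rewrite kleinMap-tabulate act↔ (a ⊕ b) | kleinMap-tabulate act↔ a | kleinMap-tabulate act↔ b
    = act-⊕ a b c

  faithful : ∀ a b → (∀ c → Inverse.to (π a) c ≡ Inverse.to (π b) c) → a ≡ b
  faithful a b rewrite kleinMap-tabulate act↔ a | kleinMap-tabulate act↔ b =
    act-faithful {p = PD} {q = FC} (λ ()) refl refl (λ ()) a b
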